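{- Let $G$ be a core graph not isomorphic to $W_5$ or $\overline{W_5}$. If $G$ contains a $5$-hole $C$, then for every vertex $u\in V(G)\setminus V(C)$, either (i) $u$ has exactly two neighbours on $C$ and they are consecutive on $C$; or (ii) $u$ has exactly three neighbours on $C$ and these three are not three consecutive vertices of $C$.
   Context: All graphs are finite and simple. A $5$-hole is an induced cycle of length $5$. $W_5$ is the $5$-wheel: a $5$-cycle plus a vertex adjacent to all its vertices. For a graph $G$, let $P(G)$ be the polytope in $\mathbb{R}^{V(G)}$ defined by $0\le x_v\le 1$ for every vertex $v$, $x_u+x_v\le 1$ for every edge $uv$, and $\sum_{v\in V(C)}x_v\le (|V(C)|-1)/2$ for every induced odd cycle $C$. $G$ is t-perfect if $P(G)$ equals the convex hull of characteristic vectors of independent sets of $G$, t-imperfect otherwise. If $N(v)$ is an independent set, the t-contraction at $v$ contracts $N(v)\cup\{v\}$ into a single vertex. A t-minor of $G$ is a graph obtained by a sequence of vertex deletions and t-contractions; it is proper if it has fewer vertices than $G$. A graph $G$ is a core graph if neither $G$ nor its complement $\overline{G}$ has a t-imperfect proper t-minor. -}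

module Defs where

open import Data.Nat using (ℕ; zero; suc; _+_; _*_; _<_)
open import Data.Fin using (Fin; zero; suc; toℕ; _≟_)
open import Data.Bool using (Bool; true; false; not; if_then_else_)
open import Data.Integer using (+_)
open import Data.Rational using (ℚ; 0ℚ; 1ℚ; _/_) renaming (_+_ to _+q_; _*_ to _*q_; _≤_ to _≤q_)
open import Data.List using (List; []; _∷_)
open import Data.Product using (Σ; ∃; _×_; _,_)
open import Data.Sum using (_⊎_)
open import Relation.Nullary using (¬_)
open import Relation.Nullary.Decidable using (⌊_⌋)
open import Relation.Binary.PropositionalEquality using (_≡_; _≢_)
open import Relation.Binary.Construct.Closure.ReflexiveTransitive using (Star)
open import Function.Definitions using (Injective; Surjective)

record Graph : Set where
  constructor mkGraph
  field
    n   : ℕ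
    adj : Fin n → Fin n → Bool
open Graph public

Edge : (G : Graph) → Fin (n G) → Fin (n G) → Set
Edge G u v = adj G u v ≡ true

Simple : Graph → Set
Simple G = (∀ u → adj G u u ≡ false) × (∀ u v → adj G u v ≡ adj G v u)

complement : Graph → Graph
complement G = mkGraph (n G) (λ u v → if ⌊ u ≟ v ⌋ then false else not (adj G u v))

record _≅_ (G H : Graph) : Set where
  field
    to      : Fin (n G) → Fin (n H)
    from    : Fin (n H) → Fin (n G)
    from-to : ∀ u → from (to u) ≡ u
    to-from : ∀ v → to (from v) ≡ v
    preserve : ∀ u v → adj H (to u) (to v) ≡ adj G u v

sumᶠ : ∀ {k} → (Fin k → ℚ) → ℚ
sumᶠ {zero}  f = 0ℚ
sumᶠ {suc k} f = f zero +q sumᶠ (λ i → f (suc i))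

countᶠ : ∀ {k} → (Fin k → Bool) → ℕ
countᶠ {zero}  f = 0
countᶠ {suc k} f = (if f zero then 1 else 0) + countᶠ (λ i → f (suc i))

sumL : List ℚ → ℚ
sumL []       = 0ℚ
sumL (x ∷ xs) = x +q sumL xs

CycAdj : (k : ℕ) → Fin k → Fin k → Set
CycAdj k i j =
  (toℕ j ≡ suc (toℕ i)) ⊎ (toℕ i ≡ suc (toℕ j)) ⊎
  ((toℕ i ≡ 0) × (suc (toℕ j) ≡ k)) ⊎ ((toℕ j ≡ 0) × (suc (toℕ i) ≡ k))

InducedCycle : (G : Graph) (k : ℕ) → (Fin k → Fin (n G)) → Set
InducedCycle G k c =
  Injective _≡_ _≡_ c × (∀ i j → (Edge G (c i) (c j) → CycAdj k i j) × (CycAdj k i j → Edge G (c i) (c j)))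

InP : (G : Graph) → (Fin (n G) → ℚ) → Set
InP G x =
  (∀ v → (0ℚ ≤q x v) × (x v ≤q 1ℚ)) ×
  (∀ u v → Edge G u v → (x u +q x v) ≤q 1ℚ) ×
  -- induced odd cycles of length 2t+3, with bound (2t+3-1)/2 = t+1
  (∀ (t : ℕ) (c : Fin (suc (suc (suc (2 * t)))) → Fin (n G)) →
     InducedCycle G (suc (suc (suc (2 * t)))) c →
     sumᶠ (λ i → x (c i)) ≤q ((+ (suc t)) / 1))

Independent : (G : Graph) → (Fin (n G) → Bool) → Set
Independent G S = ∀ u v → S u ≡ true → S v ≡ true → adj G u v ≡ false

χ : Bool → ℚ
χ true  = 1ℚ
χ false = 0ℚ

data AllL {A : Set} (P : A → Set) : List A → Set where
  []  : AllL P []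
  _∷_ : ∀ {a as} → P a → AllL P as → AllL P (a ∷ as)

mapL : {A B : Set} → (A → B) → List A → List B
mapL f []       = []
mapL f (a ∷ as) = f a ∷ mapL f as

fst : {A B : Set} → A × B → A
fst (a , b) = a

snd : {A B : Set} → A × B → B
snd (a , b) = b

InSTAB : (G : Graph) → (Fin (n G) → ℚ) → Set
InSTAB G x =
  Σ (List (ℚ × (Fin (n G) → Bool))) λ L →
    AllL (λ p → (0ℚ ≤q fst p) × Independent G (snd p)) L ×
    (sumL (mapL fst L) ≡ 1ℚ) ×
    (∀ v → x v ≡ sumL (mapL (λ p → fst p *q χ (snd p v)) L))

TPerfect : Graph → Set
TPerfect G = ∀ (x : Fin (n G) → ℚ) → (InP G x → InSTAB G x) × (InSTAB G x → InP G x)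

DeleteStep : Graph → Graph → Set
DeleteStep G H =
  (suc (n H) ≡ n G) × Σ (Fin (n H) → Fin (n G)) λ f →
    Injective _≡_ _≡_ f × (∀ i j → adj H i j ≡ adj G (f i) (f j))

InClosedNbhd : (G : Graph) → Fin (n G) → Fin (n G) → Set
InClosedNbhd G v a = (a ≡ v) ⊎ Edge G v a

-- H arises from G by t-contraction at v (N(v) independent): q is the
-- quotient map identifying exactly the vertices of N(v) ∪ {v}; two distinct
-- classes are adjacent iff some edge of G joins them.
TContractStep : Graph → Graph → Set
TContractStep G H =
  Σ (Fin (n G)) λ v →
    (∀ a b → Edge G v a → Edge G v b → adj G a b ≡ false) ×
    Σ (Fin (n G) → Fin (n H)) λ q →
      Surjective _≡_ _≡_ q ×
      (∀ a b → (q a ≡ q b → (a ≡ b ⊎ (InClosedNbhd G v a × InClosedNbhd G v b))) ×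
               ((a ≡ b ⊎ (InClosedNbhd G v a × InClosedNbhd G v b)) → q a ≡ q b)) ×
      (∀ x y → (Edge H x y → (x ≢ y) × ∃ λ a → ∃ λ b → (q a ≡ x) × (q b ≡ y) × Edge G a b) ×
               (((x ≢ y) × ∃ λ a → ∃ λ b → (q a ≡ x) × (q b ≡ y) × Edge G a b) → Edge H x y))

TStep : Graph → Graph → Set
TStep G H = DeleteStep G H ⊎ TContractStep G H

TMinor : Graph → Graph → Set
TMinor = Star TStep

ProperTMinor : Graph → Graph → Set
ProperTMinor G H = TMinor G H × (n H < n G)

HasTImperfectProperTMinor : Graph → Set
HasTImperfectProperTMinor G = ∃ λ H → ProperTMinor G H × ¬ TPerfect H

CoreGraph : Graph → Set
CoreGraph G = ¬ HasTImperfectProperTMinor G × ¬ HasTImperfectProperTMinor (complement G)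

W5adj : Fin 6 → Fin 6 → Bool
W5adj u v with toℕ u | toℕ v
... | 5 | 5 = false
... | 5 | _ = true
... | _ | 5 = true
... | a | b = rim a b
  where
  rim : ℕ → ℕ → Bool
  rim 0 1 = true
  rim 1 0 = true
  rim 1 2 = true
  rim 2 1 = true
  rim 2 3 = true
  rim 3 2 = true
  rim 3 4 = true
  rim 4 3 = true
  rim 4 0 = true
  rim 0 4 = true
  rim _ _ = false

W5 : Graph
W5 = mkGraph 6 W5adj

next5 : Fin 5 → Fin 5
next5 zero = suc zero
next5 (suc zero) = suc (suc zero)
next5 (suc (suc zero)) = suc (suc (suc zero))
next5 (suc (suc (suc zero))) = suc (suc (suc (suc zero)))
next5 (suc (suc (suc (suc zero)))) = zero

{-# OPTIONS --safe #-}
module Submission where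

-- Let b be the neighbourhood pattern of u on the 5-hole C. If u sees all of C, then C + u is an
-- induced W₅. If u sees three consecutive vertices of C but not the vertex preceding them, that
-- vertex has two non-adjacent neighbours in C + u, and t-contracting it turns C + u into K₄.
-- Both W₅ and K₄ are t-imperfect: the constant vector ⅓ lies in P but violates a stable-set
-- inequality. Since i ↦ 2i maps C onto an induced 5-hole of the complement, the same holds for
-- the complementary pattern there. In a core graph other than W₅ and its complement neither
-- pattern is therefore bad, and checking the 32 patterns leaves exactly the two admissible kinds.

open import Defs
open import Algebra.Bundles using (Ring)
open import Data.Bool using (Bool; true; false; not; if_then_else_)
open import Data.Bool.Properties using (not-involutive) renaming (_≟_ to _≟ᵇ_)
open import Data.Empty using (⊥; ⊥-elim)
open import Data.Fin using (Fin; zero; suc; toℕ; _≟_; splitAt; join; punchIn; punchOut)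
open import Data.Fin.Patterns using (0F; 1F; 2F; 3F; 4F; 5F)
open import Data.Fin.Properties
  using (all?; any?; injective⇒≤; cantor-schröder-bernstein; join-splitAt;
         punchIn-injective; punchOut-injective; punchIn-punchOut)
open import Data.Fin.Subset using (Subset)
open import Data.Fin.Subset.Properties using (anySubset?)
open import Data.Integer as ℤ using (+_)
import Data.Integer.Properties as ℤ
open import Data.List using ([]; _∷_)
open import Data.Nat as ℕ using (zero; suc)
open import Data.Nat.DivMod using (_mod_)
import Data.Nat.Properties as ℕ
open import Data.Product using (∃; _×_; _,_; proj₁; proj₂)
import Data.Product as Product
open import Data.Rational using (ℚ; 0ℚ; 1ℚ; _/_; _+_; _*_; _≤_; _<_; _≤?_; _<?_; toℚᵘ; nonNegative)
import Data.Rational.Properties as ℚ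
open import Data.Rational.Solver using (module +-*-Solver)
import Data.Rational.Unnormalised as ℚᵘ
import Data.Rational.Unnormalised.Properties as ℚᵘ
open import Data.Sum using (_⊎_; inj₁; inj₂; [_,_]′)
import Data.Sum as Sum
open import Data.Vec using (lookup; tabulate)
open import Data.Vec.Properties using (lookup∘tabulate)
open import Function using (_∘_; id)
open import Function.Definitions using (Injective)
open import Relation.Binary.Construct.Closure.ReflexiveTransitive using (ε; _◅_; _◅◅_)
open import Relation.Binary.PropositionalEquality
open import Relation.Nullary using (¬_; Dec; does; yes; no; contradiction)
open import Relation.Nullary.Decidable
  using (from-yes; ⌊_⌋; map′; decidable-stable; ¬?; _→-dec_; _×-dec_; _⊎-dec_; dec-true; dec-false)
open import Relation.Unary using (Pred; Decidable)

open import Algebra.Properties.Semiring.Sum (Ring.semiring ℚ.+-*-ring)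
  using (sum; ∑-distrib-+; *-distribˡ-sum; sum-cong-≗; sum-replicate-zero)

allSubset? : ∀ {ℓ k} {P : Pred (Subset k) ℓ} → Decidable P → Dec (∀ p → P p)
allSubset? P? = map′ (λ ¬∃¬P p → decidable-stable (P? p) (λ ¬Pp → ¬∃¬P (p , ¬Pp)))
                     (λ ∀P (p , ¬Pp) → ¬Pp (∀P p))
                     (¬? (anySubset? (¬? ∘ P?)))

avoiding-injection⇒≤ : ∀ {m k} {f : Fin m → Fin (suc k)} → Injective _≡_ _≡_ f →
                       ∀ w → (∀ i → f i ≢ w) → m ℕ.≤ k
avoiding-injection⇒≤ {f = f} f-inj w f≢w =
  injective⇒≤ {f = λ i → punchOut (f≢w i ∘ sym)}
    λ {i} {j} → f-inj ∘ punchOut-injective (f≢w i ∘ sym) (f≢w j ∘ sym)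

injective⇒surjective : ∀ {m k} {f : Fin m → Fin k} → Injective _≡_ _≡_ f → m ≡ k →
                       ∀ w → ∃ λ i → f i ≡ w
injective⇒surjective {suc m} {f = f} f-inj refl w with any? (λ i → f i ≟ w)
... | yes hit = hit
... | no ¬hit = contradiction (avoiding-injection⇒≤ f-inj w (λ i e → ¬hit (i , e))) (ℕ.n≮n m)

injective-<⇒avoids : ∀ {m k} {f : Fin m → Fin k} → Injective _≡_ _≡_ f → m ℕ.< k →
                     ∃ λ w → ∀ i → f i ≢ w
injective-<⇒avoids {f = f} f-inj m<k with any? (λ w → all? (λ i → ¬? (f i ≟ w)))
... | yes avoided = avoided
... | no ¬avoided = contradiction (injective⇒≤ preimage-injective) (ℕ.<⇒≱ m<k)
  where
  preimage : ∀ w → ∃ λ i → f i ≡ w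
  preimage w = decidable-stable (any? λ i → f i ≟ w) (λ ¬hit → ¬avoided (w , λ i e → ¬hit (i , e)))
  preimage-injective : Injective _≡_ _≡_ (proj₁ ∘ preimage)
  preimage-injective {w} {w′} e = trans (sym (proj₂ (preimage w))) (trans (cong f e) (proj₂ (preimage w′)))

injective-≟ : ∀ {m k} {f : Fin m → Fin k} → Injective _≡_ _≡_ f → ∀ i j → ⌊ f i ≟ f j ⌋ ≡ ⌊ i ≟ j ⌋
injective-≟ {f = f} f-inj i j with f i ≟ f j | i ≟ j
... | yes _     | yes _    = refl
... | no  _     | no  _    = refl
... | yes fi≡fj | no  i≢j  = contradiction (f-inj fi≡fj) i≢j
... | no  fi≢fj | yes refl = contradiction refl fi≢fj

module _ {G H : Graph} (G≅H : G ≅ H) where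
  open _≅_ G≅H

  ≅-to-injective : Injective _≡_ _≡_ to
  ≅-to-injective {a} {b} e = trans (sym (from-to a)) (trans (cong from e) (from-to b))

  ≅-from-injective : Injective _≡_ _≡_ from
  ≅-from-injective {x} {y} e = trans (sym (to-from x)) (trans (cong to e) (to-from y))

  ≅⇒≡ : n G ≡ n H
  ≅⇒≡ = cantor-schröder-bernstein ≅-to-injective ≅-from-injective

complement-adj-≢ : ∀ {G u v} → u ≢ v → adj (complement G) u v ≡ not (adj G u v)
complement-adj-≢ {u = u} {v} u≢v with u ≟ v
... | yes u≡v = contradiction u≡v u≢v
... | no  _   = refl

complement-simple : ∀ {G} → Simple G → Simple (complement G)
complement-simple {G} (_ , adj-sym) = irreflexive , symmetric
  where
  irreflexive : ∀ u → adj (complement G) u u ≡ false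
  irreflexive u with u ≟ u
  ... | yes _   = refl
  ... | no  u≢u = contradiction refl u≢u
  symmetric : ∀ u v → adj (complement G) u v ≡ adj (complement G) v u
  symmetric u v with u ≟ v | v ≟ u
  ... | yes _    | yes _    = refl
  ... | no  _    | no  _    = cong not (adj-sym u v)
  ... | yes refl | no  u≢u  = contradiction refl u≢u
  ... | no  u≢u  | yes refl = contradiction refl u≢u

complement-≅ : ∀ {G H} → Simple G → complement G ≅ H → G ≅ complement H
complement-≅ {G} {H} (irreflexive , _) Gᶜ≅H = record
  { to = to ; from = from ; from-to = from-to ; to-from = to-from ; preserve = preserve′ }
  where
  open _≅_ Gᶜ≅H
  preserve′ : ∀ u v → adj (complement H) (to u) (to v) ≡ adj G u v
  preserve′ u v rewrite injective-≟ (≅-to-injective Gᶜ≅H) u v | preserve u v with u ≟ v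
  ... | yes refl = sym (irreflexive u)
  ... | no  _    = not-involutive (adj G u v)

-- Induced subgraphs and t-minors

record InducedSubgraph (H G : Graph) : Set where
  constructor induced
  field
    embedding : Fin (n H) → Fin (n G)
    injective : Injective _≡_ _≡_ embedding
    adjacency : ∀ i j → adj H i j ≡ adj G (embedding i) (embedding j)

induced-trans : ∀ {K H G} → InducedSubgraph K H → InducedSubgraph H G → InducedSubgraph K G
induced-trans (induced f f-inj f-adj) (induced g g-inj g-adj) =
  induced (g ∘ f) (f-inj ∘ g-inj) λ i j → trans (f-adj i j) (g-adj (f i) (f j))

induced⇒TMinor : ∀ d {G H} → n G ≡ suc (d ℕ.+ n H) → InducedSubgraph H G → TMinor G H
induced⇒TMinor zero    G≡1+H (induced f f-inj f-adj) = inj₁ (sym G≡1+H , f , f-inj , f-adj) ◅ ε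
induced⇒TMinor (suc d) {mkGraph _ a} {H} refl (induced f f-inj f-adj) =
  inj₁ (refl , punchIn w , punchIn-injective w _ _ , λ _ _ → refl) ◅
  induced⇒TMinor d refl (induced f′ f′-injective f′-adj)
  where
  avoided = injective-<⇒avoids f-inj (ℕ.s≤s (ℕ.m≤n+m (n H) (suc d)))
  w = proj₁ avoided
  w≢f : ∀ i → w ≢ f i
  w≢f i = proj₂ avoided i ∘ sym
  f′ : Fin (n H) → Fin (suc (d ℕ.+ n H))
  f′ i = punchOut (w≢f i)
  f′-injective : Injective _≡_ _≡_ f′
  f′-injective e = f-inj (punchOut-injective (w≢f _) (w≢f _) e)
  f′-adj : ∀ i j → adj H i j ≡ a (punchIn w (f′ i)) (punchIn w (f′ j))
  f′-adj i j = trans (f-adj i j) (sym (cong₂ a (punchIn-punchOut (w≢f i)) (punchIn-punchOut (w≢f j))))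

induced-spanning⇒≅ : ∀ {H G} → n H ≡ n G → InducedSubgraph H G → G ≅ H
induced-spanning⇒≅ {H} {G} H≡G (induced f f-inj f-adj) = record
  { to       = proj₁ ∘ preimage
  ; from     = f
  ; from-to  = proj₂ ∘ preimage
  ; to-from  = λ i → f-inj (proj₂ (preimage (f i)))
  ; preserve = λ a b → trans (f-adj _ _) (cong₂ (adj G) (proj₂ (preimage a)) (proj₂ (preimage b)))
  }
  where
  preimage = injective⇒surjective f-inj H≡G

induced⇒≅⊎ProperTMinor : ∀ {H G} → InducedSubgraph H G → G ≅ H ⊎ ProperTMinor G H
induced⇒≅⊎ProperTMinor {H} {G} H⊑G@(induced _ f-inj _) with ℕ.m≤n⇒∃[o]m+o≡n (injective⇒≤ f-inj)
... | zero  , H+0≡G   = inj₁ (induced-spanning⇒≅ (trans (sym (ℕ.+-identityʳ (n H))) H+0≡G) H⊑G)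
... | suc d , H+1+d≡G =
  inj₂ (induced⇒TMinor d G≡1+d+H H⊑G , subst (n H ℕ.<_) (sym G≡1+d+H) (ℕ.s≤s (ℕ.m≤n+m (n H) d)))
  where
  G≡1+d+H : n G ≡ suc (d ℕ.+ n H)
  G≡1+d+H = trans (sym H+1+d≡G) (trans (ℕ.+-suc (n H) d) (cong suc (ℕ.+-comm (n H) d)))

induced-imperfect⇒≅⊎imperfect-minor : ∀ {H G} → InducedSubgraph H G → ¬ TPerfect H →
                                      G ≅ H ⊎ HasTImperfectProperTMinor G
induced-imperfect⇒≅⊎imperfect-minor {H} H⊑G H-imperfect =
  Sum.map₂ (λ G↝H → H , G↝H , H-imperfect) (induced⇒≅⊎ProperTMinor H⊑G)

-- t-contractions

Merged : (G : Graph) → Fin (n G) → Fin (n G) → Fin (n G) → Set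
Merged G v a b = a ≡ b ⊎ (InClosedNbhd G v a × InClosedNbhd G v b)

Joined : (G H : Graph) → (Fin (n G) → Fin (n H)) → Fin (n H) → Fin (n H) → Set
Joined G H q x y = (x ≢ y) × ∃ λ a → ∃ λ b → (q a ≡ x) × (q b ≡ y) × Edge G a b

ContractsTo : (G H : Graph) → Fin (n G) → (Fin (n G) → Fin (n H)) → Set
ContractsTo G H v q =
  (∀ a b → Edge G v a → Edge G v b → adj G a b ≡ false) ×
  (∀ y → ∃ λ x → q x ≡ y) ×
  (∀ a b → (q a ≡ q b → Merged G v a b) × (Merged G v a b → q a ≡ q b)) ×
  (∀ x y → (Edge H x y → Joined G H q x y) × (Joined G H q x y → Edge H x y))

contractsTo? : ∀ G H v q → Dec (ContractsTo G H v q)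
contractsTo? G H v q =
  (all? λ a → all? λ b → edge? G v a →-dec edge? G v b →-dec (adj G a b ≟ᵇ false)) ×-dec
  (all? λ y → any? λ x → q x ≟ y) ×-dec
  (all? λ a → all? λ b → ((q a ≟ q b) →-dec merged? a b) ×-dec (merged? a b →-dec (q a ≟ q b))) ×-dec
  (all? λ x → all? λ y → (edge? H x y →-dec joined? x y) ×-dec (joined? x y →-dec edge? H x y))
  where
  edge? : ∀ K u w → Dec (Edge K u w)
  edge? K u w = adj K u w ≟ᵇ true
  closed? : ∀ a → Dec (InClosedNbhd G v a)
  closed? a = (a ≟ v) ⊎-dec edge? G v a
  merged? : ∀ a b → Dec (Merged G v a b)
  merged? a b = (a ≟ b) ⊎-dec (closed? a ×-dec closed? b)
  joined? : ∀ x y → Dec (Joined G H q x y)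
  joined? x y = ¬? (x ≟ y) ×-dec any? λ a → any? λ b → (q a ≟ x) ×-dec (q b ≟ y) ×-dec edge? G a b

contractsTo⇒TContractStep : ∀ {G H v q} → ContractsTo G H v q → TContractStep G H
contractsTo⇒TContractStep {v = v} {q} (independent , onto , merging , joining) =
  v , independent , q , surjective , merging , joining
  where
  surjective : ∀ y → ∃ λ x → ∀ {z} → z ≡ x → q z ≡ y
  surjective y = proj₁ (onto y) , λ z≡x → trans (cong q z≡x) (proj₂ (onto y))

≅-contractsTo : ∀ {G H K v q} (G≅H : G ≅ H) → ContractsTo H K v q →
                ContractsTo G K (_≅_.from G≅H v) (q ∘ _≅_.to G≅H)
≅-contractsTo {G} {H} {K} {v} {q} G≅H (independent , onto , merging , joining) =
  independent′ , onto′ , merging′ , joining′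
  where
  open _≅_ G≅H
  adj-to : ∀ x a → adj H x (to a) ≡ adj G (from x) a
  adj-to x a = trans (cong (λ y → adj H y (to a)) (sym (to-from x))) (preserve (from x) a)
  independent′ : ∀ a b → Edge G (from v) a → Edge G (from v) b → adj G a b ≡ false
  independent′ a b va vb =
    trans (sym (preserve a b)) (independent (to a) (to b) (trans (adj-to v a) va) (trans (adj-to v b) vb))
  onto′ : ∀ y → ∃ λ x → q (to x) ≡ y
  onto′ y = from (proj₁ (onto y)) , trans (cong q (to-from _)) (proj₂ (onto y))
  closed→ : ∀ {a} → InClosedNbhd H v (to a) → InClosedNbhd G (from v) a
  closed→ {a} (inj₁ a↦v) = inj₁ (trans (sym (from-to a)) (cong from a↦v))
  closed→ {a} (inj₂ va)  = inj₂ (trans (sym (adj-to v a)) va)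
  closed← : ∀ {a} → InClosedNbhd G (from v) a → InClosedNbhd H v (to a)
  closed← {a} (inj₁ a≡v) = inj₁ (trans (cong to a≡v) (to-from v))
  closed← {a} (inj₂ va)  = inj₂ (trans (adj-to v a) va)
  merging′ : ∀ a b → (q (to a) ≡ q (to b) → Merged G (from v) a b) ×
                     (Merged G (from v) a b → q (to a) ≡ q (to b))
  merging′ a b = Sum.map (≅-to-injective G≅H) (Product.map closed→ closed→) ∘ proj₁ (merging (to a) (to b))
               , proj₂ (merging (to a) (to b)) ∘ Sum.map (cong to) (Product.map closed← closed←)
  joined→ : ∀ {x y} → Joined H K q x y → Joined G K (q ∘ to) x y
  joined→ (x≢y , a , b , qa , qb , ab) =
    x≢y , from a , from b , trans (cong q (to-from a)) qa , trans (cong q (to-from b)) qb ,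
    trans (sym (preserve (from a) (from b))) (trans (cong₂ (adj H) (to-from a) (to-from b)) ab)
  joined← : ∀ {x y} → Joined G K (q ∘ to) x y → Joined H K q x y
  joined← (x≢y , a , b , qa , qb , ab) = x≢y , to a , to b , qa , qb , trans (preserve a b) ab
  joining′ : ∀ x y → (Edge K x y → Joined G K (q ∘ to) x y) × (Joined G K (q ∘ to) x y → Edge K x y)
  joining′ x y = joined→ ∘ proj₁ (joining x y) , proj₂ (joining x y) ∘ joined←

induced-contraction⇒imperfect-minor : ∀ {G H K v q} → InducedSubgraph H G → ContractsTo H K v q →
                                      n K ℕ.< n H → ¬ TPerfect K → HasTImperfectProperTMinor G
induced-contraction⇒imperfect-minor {K = K} H⊑G H↠K K<H K-imperfect with induced⇒≅⊎ProperTMinor H⊑G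
... | inj₁ G≅H =
  K , (inj₂ (contractsTo⇒TContractStep (≅-contractsTo G≅H H↠K)) ◅ ε ,
       subst (n K ℕ.<_) (sym (≅⇒≡ G≅H)) K<H) , K-imperfect
... | inj₂ (G↝H , H<G) =
  K , (G↝H ◅◅ (inj₂ (contractsTo⇒TContractStep H↠K) ◅ ε) , ℕ.<-trans K<H H<G) , K-imperfect

-- The polytope P and t-imperfection of K₄ and W₅

⅓ : ℚ
⅓ = + 1 / 3

[1+m]/1≡1+m/1 : ∀ m → + suc m / 1 ≡ 1ℚ + + m / 1
[1+m]/1≡1+m/1 m = ℚ.toℚᵘ-injective (begin
  toℚᵘ (+ suc m / 1)             ≈⟨ ℚ.toℚᵘ-fromℚᵘ (ℚᵘ.mkℚᵘ (+ suc m) 0) ⟩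
  ℚᵘ.mkℚᵘ (+ suc m) 0            ≈⟨ ℚᵘ.*≡* (cong (λ k → (+ 1 ℤ.+ k) ℤ.* + 1) (sym (ℤ.*-identityʳ (+ m)))) ⟩
  ℚᵘ.1ℚᵘ ℚᵘ.+ ℚᵘ.mkℚᵘ (+ m) 0    ≈⟨ ℚᵘ.+-congʳ ℚᵘ.1ℚᵘ (ℚᵘ.≃-sym (ℚ.toℚᵘ-fromℚᵘ (ℚᵘ.mkℚᵘ (+ m) 0))) ⟩
  toℚᵘ 1ℚ ℚᵘ.+ toℚᵘ (+ m / 1)    ≈⟨ ℚᵘ.≃-sym (ℚ.toℚᵘ-homo-+ 1ℚ (+ m / 1)) ⟩
  toℚᵘ (1ℚ + + m / 1)            ∎)
  where open import Relation.Binary.Reasoning.Setoid ℚᵘ.≃-setoid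

sum-⅓-odd : ∀ t → sumᶠ {3 ℕ.+ 2 ℕ.* t} (λ _ → ⅓) ≤ + suc t / 1
sum-⅓-odd zero    = from-yes (sumᶠ {3} (λ _ → ⅓) ≤? 1ℚ)
sum-⅓-odd (suc t) = subst (λ k → sumᶠ {3 ℕ.+ k} (λ _ → ⅓) ≤ + suc (suc t) / 1) (sym (ℕ.*-suc 2 t)) (begin
  ⅓ + (⅓ + s)         ≡⟨ ℚ.+-assoc ⅓ ⅓ s ⟨
  (⅓ + ⅓) + s         ≤⟨ ℚ.+-mono-≤ (from-yes (⅓ + ⅓ ≤? 1ℚ)) (sum-⅓-odd t) ⟩
  1ℚ + + suc t / 1    ≡⟨ [1+m]/1≡1+m/1 (suc t) ⟨
  + suc (suc t) / 1   ∎)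
  where
  open ℚ.≤-Reasoning
  s = sumᶠ {3 ℕ.+ 2 ℕ.* t} (λ _ → ⅓)

⅓∈P : ∀ H → InP H (λ _ → ⅓)
⅓∈P H = (λ _ → from-yes (0ℚ ≤? ⅓) , from-yes (⅓ ≤? 1ℚ)) ,
        (λ _ _ _ → from-yes (⅓ + ⅓ ≤? 1ℚ)) ,
        (λ t _ _ → sum-⅓-odd t)

sumᶠ≡sum : ∀ {k} (f : Fin k → ℚ) → sumᶠ f ≡ sum f
sumᶠ≡sum {zero}  f = refl
sumᶠ≡sum {suc k} f = cong (λ s → f zero + s) (sumᶠ≡sum (f ∘ suc))

sumᶠ-cong : ∀ {k} {f g : Fin k → ℚ} → (∀ v → f v ≡ g v) → sumᶠ f ≡ sumᶠ g
sumᶠ-cong {f = f} {g} f≗g = trans (sumᶠ≡sum f) (trans (sum-cong-≗ f≗g) (sym (sumᶠ≡sum g)))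

sumᶠ-linear : ∀ {k} (l : ℚ) (f g : Fin k → ℚ) → sumᶠ (λ v → l * f v + g v) ≡ l * sumᶠ f + sumᶠ g
sumᶠ-linear l f g = begin
  sumᶠ (λ v → l * f v + g v)   ≡⟨ sumᶠ≡sum (λ v → l * f v + g v) ⟩
  sum (λ v → l * f v + g v)    ≡⟨ ∑-distrib-+ (λ v → l * f v) g ⟩
  sum (λ v → l * f v) + sum g  ≡⟨ cong₂ _+_ (*-distribˡ-sum l f) (sumᶠ≡sum g) ⟨
  l * sum f + sumᶠ g           ≡⟨ cong (λ s → l * s + sumᶠ g) (sumᶠ≡sum f) ⟨
  l * sumᶠ f + sumᶠ g          ∎
  where open ≡-Reasoning

StableSetInequality : (H : Graph) → (Fin (n H) → ℚ) → ℚ → Set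
StableSetInequality H a β = ∀ S → Independent H S → sumᶠ (λ v → a v * χ (S v)) ≤ β

module _ (H : Graph) (a : Fin (n H) → ℚ) (β : ℚ) (valid : StableSetInequality H a β) where

  combination-bound : ∀ L → AllL (λ p → (0ℚ ≤ fst p) × Independent H (snd p)) L →
                      sumᶠ (λ v → a v * sumL (mapL (λ p → fst p * χ (snd p v)) L)) ≤ β * sumL (mapL fst L)
  combination-bound [] [] = ℚ.≤-reflexive (begin
    sumᶠ (λ v → a v * 0ℚ)   ≡⟨ sumᶠ≡sum (λ v → a v * 0ℚ) ⟩
    sum (λ v → a v * 0ℚ)    ≡⟨ sum-cong-≗ (λ v → ℚ.*-zeroʳ (a v)) ⟩
    sum {n H} (λ _ → 0ℚ)    ≡⟨ sum-replicate-zero (n H) ⟩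
    0ℚ                      ≡⟨ ℚ.*-zeroʳ β ⟨
    β * 0ℚ                  ∎)
    where open ≡-Reasoning
  combination-bound ((l , S) ∷ L) ((0≤l , independent) ∷ all) = begin
    sumᶠ (λ v → a v * (l * χ (S v) + x v))          ≡⟨ sumᶠ-cong (λ v → distribute (a v) l (χ (S v)) (x v)) ⟩
    sumᶠ (λ v → l * (a v * χ (S v)) + a v * x v)    ≡⟨ sumᶠ-linear l (λ v → a v * χ (S v)) (λ v → a v * x v) ⟩
    l * sumᶠ (λ v → a v * χ (S v)) + sumᶠ (λ v → a v * x v)
      ≤⟨ ℚ.+-mono-≤ (ℚ.*-monoˡ-≤-nonNeg l {{nonNegative 0≤l}} (valid S independent)) (combination-bound L all) ⟩
    l * β + β * w                                   ≡⟨ collect l β w ⟩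
    β * (l + w)                                     ∎
    where
    open ℚ.≤-Reasoning
    open +-*-Solver
    x : Fin (n H) → ℚ
    x v = sumL (mapL (λ p → fst p * χ (snd p v)) L)
    w : ℚ
    w = sumL (mapL fst L)
    distribute : ∀ a l c r → a * (l * c + r) ≡ l * (a * c) + a * r
    distribute = solve 4 (λ a l c r → a :* (l :* c :+ r) := l :* (a :* c) :+ a :* r) refl
    collect : ∀ l β w → l * β + β * w ≡ β * (l + w)
    collect = solve 3 (λ l β w → l :* β :+ β :* w := β :* (l :+ w)) refl

valid-on-STAB : ∀ {H a β x} → StableSetInequality H a β → InSTAB H x → sumᶠ (λ v → a v * x v) ≤ β
valid-on-STAB {H} {a} {β} {x} valid (L , members , weight≡1 , x≡) = begin
  sumᶠ (λ v → a v * x v)       ≡⟨ sumᶠ-cong (λ v → cong (a v *_) (x≡ v)) ⟩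
  sumᶠ (λ v → a v * sumL (mapL (λ p → fst p * χ (snd p v)) L))
                               ≤⟨ combination-bound H a β valid L members ⟩
  β * sumL (mapL fst L)        ≡⟨ cong (β *_) weight≡1 ⟩
  β * 1ℚ                       ≡⟨ ℚ.*-identityʳ β ⟩
  β                            ∎
  where open ℚ.≤-Reasoning

violated-by-⅓⇒t-imperfect : ∀ {H a β} → StableSetInequality H a β → β < sumᶠ (λ v → a v * ⅓) →
                            ¬ TPerfect H
violated-by-⅓⇒t-imperfect {H} {a} {β} valid β<a⅓ perfect =
  ℚ.<-irrefl refl (ℚ.<-≤-trans β<a⅓ (valid-on-STAB {H} {a} {β} valid ⅓∈STAB))
  where
  ⅓∈STAB = proj₁ (perfect (λ _ → ⅓)) (⅓∈P H)

independent? : ∀ H S → Dec (Independent H S)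
independent? H S = all? λ u → all? λ v → (S u ≟ᵇ true) →-dec (S v ≟ᵇ true) →-dec (adj H u v ≟ᵇ false)

StableSetInequalityOnSubsets : (H : Graph) → (Fin (n H) → ℚ) → ℚ → Set
StableSetInequalityOnSubsets H a β =
  ∀ p → Independent H (lookup p) → sumᶠ (λ v → a v * χ (lookup p v)) ≤ β

stableSetInequalityOnSubsets? : ∀ H a β → Dec (StableSetInequalityOnSubsets H a β)
stableSetInequalityOnSubsets? H a β =
  allSubset? λ p → independent? H (lookup p) →-dec (sumᶠ (λ v → a v * χ (lookup p v)) ≤? β)

onSubsets⇒StableSetInequality : ∀ {H a β} → StableSetInequalityOnSubsets H a β → StableSetInequality H a β
onSubsets⇒StableSetInequality {H} {a} {β} valid S independent =
  subst (_≤ β) (sumᶠ-cong (λ v → cong (λ b → a v * χ b) (S≗ v)))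
    (valid (tabulate S) λ u v Su Sv → independent u v (trans (sym (S≗ u)) Su) (trans (sym (S≗ v)) Sv))
  where
  S≗ = lookup∘tabulate S

K4 : Graph
K4 = mkGraph 4 λ u v → not ⌊ u ≟ v ⌋

K4-t-imperfect : ¬ TPerfect K4
K4-t-imperfect = violated-by-⅓⇒t-imperfect {K4} {λ _ → 1ℚ} {1ℚ}
  (onSubsets⇒StableSetInequality {K4} {λ _ → 1ℚ} {1ℚ}
    (from-yes (stableSetInequalityOnSubsets? K4 (λ _ → 1ℚ) 1ℚ)))
  (from-yes (1ℚ <? sumᶠ {4} (λ _ → 1ℚ * ⅓)))

W5-weight : Fin 6 → ℚ
W5-weight v = [ (λ _ → 1ℚ) , (λ _ → + 2 / 1) ]′ (splitAt 5 v)

W5-t-imperfect : ¬ TPerfect W5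
W5-t-imperfect = violated-by-⅓⇒t-imperfect {W5} {W5-weight} {+ 2 / 1}
  (onSubsets⇒StableSetInequality {W5} {W5-weight} {+ 2 / 1}
    (from-yes (stableSetInequalityOnSubsets? W5 W5-weight (+ 2 / 1))))
  (from-yes (+ 2 / 1 <? sumᶠ (λ v → W5-weight v * ⅓)))

-- Five-holes and their apex extensions

cycAdj? : ∀ {k} (i j : Fin k) → Dec (CycAdj k i j)
cycAdj? {k} i j =
  (toℕ j ℕ.≟ suc (toℕ i)) ⊎-dec (toℕ i ℕ.≟ suc (toℕ j)) ⊎-dec
  ((toℕ i ℕ.≟ 0) ×-dec (suc (toℕ j) ℕ.≟ k)) ⊎-dec ((toℕ j ℕ.≟ 0) ×-dec (suc (toℕ i) ℕ.≟ k))

cycleAdj : ∀ {k} → Fin k → Fin k → Bool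
cycleAdj i j = does (cycAdj? i j)

inducedCycle-adj : ∀ {G k c} → InducedCycle G k c → ∀ i j → adj G (c i) (c j) ≡ cycleAdj i j
inducedCycle-adj {G} {c = c} (_ , edge⇔cycAdj) i j with adj G (c i) (c j) in e
... | true  = sym (dec-true (cycAdj? i j) (proj₁ (edge⇔cycAdj i j) e))
... | false = sym (dec-false (cycAdj? i j) λ ij → contradiction (trans (sym e) (proj₂ (edge⇔cycAdj i j) ij)) λ ())

record Hole₅ (G : Graph) (c : Fin 5 → Fin (n G)) : Set where
  constructor hole₅
  field
    injective : Injective _≡_ _≡_ c
    adjacency : ∀ i j → adj G (c i) (c j) ≡ cycleAdj i j

rotate : Fin 5 → Fin 5 → Fin 5
rotate m i = (toℕ m ℕ.+ toℕ i) mod 5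

-- i ↦ 2i is an isomorphism from C₅ onto its complement.
pentagram : Fin 5 → Fin 5
pentagram i = (2 ℕ.* toℕ i) mod 5

rotate-injective : ∀ m → Injective _≡_ _≡_ (rotate m)
rotate-injective m {i} {j} =
  from-yes (all? λ m → all? λ i → all? λ j → (rotate m i ≟ rotate m j) →-dec (i ≟ j)) m i j

rotate-cycleAdj : ∀ m i j → cycleAdj (rotate m i) (rotate m j) ≡ cycleAdj i j
rotate-cycleAdj = from-yes (all? λ m → all? λ i → all? λ j → cycleAdj (rotate m i) (rotate m j) ≟ᵇ cycleAdj i j)

pentagram-injective : Injective _≡_ _≡_ pentagram
pentagram-injective {i} {j} = from-yes (all? λ i → all? λ j → (pentagram i ≟ pentagram j) →-dec (i ≟ j)) i j

pentagram-cycleAdjᶜ : ∀ i j →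
  (if ⌊ i ≟ j ⌋ then false else not (cycleAdj (pentagram i) (pentagram j))) ≡ cycleAdj i j
pentagram-cycleAdjᶜ = from-yes (all? λ i → all? λ j →
  (if ⌊ i ≟ j ⌋ then false else not (cycleAdj (pentagram i) (pentagram j))) ≟ᵇ cycleAdj i j)

Hole₅-rotate : ∀ {G c} → Hole₅ G c → ∀ m → Hole₅ G (c ∘ rotate m)
Hole₅-rotate (hole₅ c-inj c-adj) m =
  hole₅ (rotate-injective m ∘ c-inj) λ i j → trans (c-adj _ _) (rotate-cycleAdj m i j)

Hole₅-complement : ∀ {G c} → Hole₅ G c → Hole₅ (complement G) (c ∘ pentagram)
Hole₅-complement {G} {c} (hole₅ c-inj c-adj) = hole₅ c∘π-injective λ i j → begin
  adj (complement G) (c (pentagram i)) (c (pentagram j))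
    ≡⟨ cong (λ d → if d then false else not (adj G (c (pentagram i)) (c (pentagram j))))
            (injective-≟ c∘π-injective i j) ⟩
  (if ⌊ i ≟ j ⌋ then false else not (adj G (c (pentagram i)) (c (pentagram j))))
    ≡⟨ cong (λ b → if ⌊ i ≟ j ⌋ then false else not b) (c-adj (pentagram i) (pentagram j)) ⟩
  (if ⌊ i ≟ j ⌋ then false else not (cycleAdj (pentagram i) (pentagram j)))
    ≡⟨ pentagram-cycleAdjᶜ i j ⟩
  cycleAdj i j ∎
  where
  open ≡-Reasoning
  c∘π-injective : Injective _≡_ _≡_ (c ∘ pentagram)
  c∘π-injective = pentagram-injective ∘ c-inj

apexAdj : (Fin 5 → Bool) → Fin 5 ⊎ Fin 1 → Fin 5 ⊎ Fin 1 → Bool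
apexAdj b (inj₁ i) (inj₁ j) = cycleAdj i j
apexAdj b (inj₁ i) (inj₂ _) = b i
apexAdj b (inj₂ _) (inj₁ j) = b j
apexAdj b (inj₂ _) (inj₂ _) = false

Apex : (Fin 5 → Bool) → Graph
Apex b = mkGraph 6 λ i j → apexAdj b (splitAt 5 i) (splitAt 5 j)

Apex-cong : ∀ {b b′} → (∀ i → b i ≡ b′ i) → Apex b ≅ Apex b′
Apex-cong {b} {b′} b≗b′ = record
  { to = id ; from = id ; from-to = λ _ → refl ; to-from = λ _ → refl
  ; preserve = λ i j → apexAdj-cong (splitAt 5 i) (splitAt 5 j) }
  where
  apexAdj-cong : ∀ x y → apexAdj b′ x y ≡ apexAdj b x y
  apexAdj-cong (inj₁ i) (inj₁ j) = refl
  apexAdj-cong (inj₁ i) (inj₂ _) = sym (b≗b′ i)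
  apexAdj-cong (inj₂ _) (inj₁ j) = sym (b≗b′ j)
  apexAdj-cong (inj₂ _) (inj₂ _) = refl

apex-induced : ∀ {G c u b} → Simple G → Hole₅ G c → (∀ i → c i ≢ u) → (∀ i → adj G u (c i) ≡ b i) →
               InducedSubgraph (Apex b) G
apex-induced {G} {c} {u} {b} (irreflexive , adj-sym) (hole₅ c-inj c-adj) u∉c u-adj =
  induced (place ∘ splitAt 5) injective λ i j → place-adj (splitAt 5 i) (splitAt 5 j)
  where
  place : Fin 5 ⊎ Fin 1 → Fin (n G)
  place = [ c , (λ _ → u) ]′
  place-injective : ∀ x y → place x ≡ place y → x ≡ y
  place-injective (inj₁ i)  (inj₁ j)  e = cong inj₁ (c-inj e)
  place-injective (inj₁ i)  (inj₂ _)  e = contradiction e (u∉c i)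
  place-injective (inj₂ _)  (inj₁ j)  e = contradiction (sym e) (u∉c j)
  place-injective (inj₂ 0F) (inj₂ 0F) _ = refl
  injective : Injective _≡_ _≡_ (place ∘ splitAt 5)
  injective {i} {j} e = trans (sym (join-splitAt 5 1 i))
    (trans (cong (join 5 1) (place-injective (splitAt 5 i) (splitAt 5 j) e)) (join-splitAt 5 1 j))
  place-adj : ∀ x y → apexAdj b x y ≡ adj G (place x) (place y)
  place-adj (inj₁ i) (inj₁ j) = sym (c-adj i j)
  place-adj (inj₁ i) (inj₂ _) = sym (trans (adj-sym (c i) u) (u-adj i))
  place-adj (inj₂ _) (inj₁ j) = sym (u-adj j)
  place-adj (inj₂ _) (inj₂ _) = sym (irreflexive u)

W5⊑Apex : InducedSubgraph W5 (Apex λ _ → true)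
W5⊑Apex = induced id id (from-yes (all? λ i → all? λ j → W5adj i j ≟ᵇ adj (Apex λ _ → true) i j))

FanShaped : (Fin 5 → Bool) → Set
FanShaped b = b 0F ≡ true × b 1F ≡ true × b 2F ≡ true × b 4F ≡ false

fanShaped? : ∀ b → Dec (FanShaped b)
fanShaped? b = (b 0F ≟ᵇ true) ×-dec (b 1F ≟ᵇ true) ×-dec (b 2F ≟ᵇ true) ×-dec (b 4F ≟ᵇ false)

fanQuotient : Fin 6 → Fin 4
fanQuotient 0F = 3F
fanQuotient 1F = 0F
fanQuotient 2F = 1F
fanQuotient 3F = 3F
fanQuotient 4F = 3F
fanQuotient 5F = 2F

-- In Apex b the rim vertex 4 has neighbours 3 and 0 only (b 4 = false); contracting them leaves
-- the triangle 1, 2, 5 (the apex) and the merged vertex {3, 4, 0}, which sees all three.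
fan-contracts : ∀ {b} → FanShaped b → ContractsTo (Apex b) K4 4F fanQuotient
fan-contracts {b} fan = ≅-contractsTo (Apex-cong (sym ∘ lookup∘tabulate b))
  (from-yes (allSubset? λ p → fanShaped? (lookup p) →-dec contractsTo? (Apex (lookup p)) K4 4F fanQuotient)
    (tabulate b) fan)

-- Neighbourhood patterns on a five-hole

Admissible : (Fin 5 → Bool) → Set
Admissible b =
  (countᶠ b ≡ 2 × ∃ λ m → b m ≡ true × b (next5 m) ≡ true) ⊎
  (countᶠ b ≡ 3 × ¬ (∃ λ m → b m ≡ true × b (next5 m) ≡ true × b (next5 (next5 m)) ≡ true))

admissible? : ∀ b → Dec (Admissible b)
admissible? b =
  ((countᶠ b ℕ.≟ 2) ×-dec any? λ m → (b m ≟ᵇ true) ×-dec (b (next5 m) ≟ᵇ true)) ⊎-dec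
  ((countᶠ b ℕ.≟ 3) ×-dec
    ¬? (any? λ m → (b m ≟ᵇ true) ×-dec (b (next5 m) ≟ᵇ true) ×-dec (b (next5 (next5 m)) ≟ᵇ true)))

countᶠ-cong : ∀ {k} {b b′ : Fin k → Bool} → (∀ i → b i ≡ b′ i) → countᶠ b ≡ countᶠ b′
countᶠ-cong {zero}  b≗b′ = refl
countᶠ-cong {suc k} b≗b′ = cong₂ (λ x y → (if x then 1 else 0) ℕ.+ y) (b≗b′ zero) (countᶠ-cong (b≗b′ ∘ suc))

Admissible-resp : ∀ {b b′} → (∀ i → b i ≡ b′ i) → Admissible b → Admissible b′
Admissible-resp b≗b′ (inj₁ (count≡2 , m , bm , bm+1)) =
  inj₁ (trans (sym (countᶠ-cong b≗b′)) count≡2 , m , trans (sym (b≗b′ _)) bm , trans (sym (b≗b′ _)) bm+1)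
Admissible-resp b≗b′ (inj₂ (count≡3 , ¬three)) =
  inj₂ (trans (sym (countᶠ-cong b≗b′)) count≡3 ,
        λ (m , bm , bm+1 , bm+2) → ¬three (m , trans (b≗b′ _) bm , trans (b≗b′ _) bm+1 , trans (b≗b′ _) bm+2))

Bad : (Fin 5 → Bool) → Set
Bad b = (∀ i → b i ≡ true) ⊎ ∃ λ m → FanShaped (b ∘ rotate m)

bad? : ∀ b → Dec (Bad b)
bad? b = (all? λ i → b i ≟ᵇ true) ⊎-dec any? λ m → fanShaped? (b ∘ rotate m)

Bad-resp : ∀ {b b′} → (∀ i → b i ≡ b′ i) → Bad b → Bad b′
Bad-resp b≗b′ (inj₁ all-true) = inj₁ λ i → trans (sym (b≗b′ i)) (all-true i)
Bad-resp b≗b′ (inj₂ (m , b0 , b1 , b2 , b4)) =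
  inj₂ (m , trans (sym (b≗b′ _)) b0 , trans (sym (b≗b′ _)) b1 , trans (sym (b≗b′ _)) b2 , trans (sym (b≗b′ _)) b4)

complementPattern : (Fin 5 → Bool) → Fin 5 → Bool
complementPattern b = not ∘ b ∘ pentagram

classify : ∀ b → Admissible b ⊎ Bad b ⊎ Bad (complementPattern b)
classify b = Sum.map (Admissible-resp b≗) (Sum.map (Bad-resp b≗) (Bad-resp (cong not ∘ b≗ ∘ pentagram)))
  (from-yes (allSubset? λ p → admissible? (lookup p) ⊎-dec bad? (lookup p) ⊎-dec bad? (complementPattern (lookup p)))
    (tabulate b))
  where
  b≗ = lookup∘tabulate b

bad-pattern⇒W5⊎imperfect : ∀ {G c u b} → Simple G → Hole₅ G c → (∀ i → c i ≢ u) →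
                            (∀ i → adj G u (c i) ≡ b i) → Bad b → G ≅ W5 ⊎ HasTImperfectProperTMinor G
bad-pattern⇒W5⊎imperfect simple hole u∉c u-adj (inj₁ all-true) =
  induced-imperfect⇒≅⊎imperfect-minor
    (induced-trans W5⊑Apex (apex-induced simple hole u∉c λ i → trans (u-adj i) (all-true i))) W5-t-imperfect
bad-pattern⇒W5⊎imperfect simple hole u∉c u-adj (inj₂ (m , fan)) =
  inj₂ (induced-contraction⇒imperfect-minor
    (apex-induced simple (Hole₅-rotate hole m) (u∉c ∘ rotate m) (u-adj ∘ rotate m)) (fan-contracts fan)
    (ℕ.s≤s (ℕ.s≤s (ℕ.s≤s (ℕ.s≤s (ℕ.s≤s ℕ.z≤n))))) K4-t-imperfect)

lemma6 : (G : Graph) → Simple G → CoreGraph G →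
    ¬ (G ≅ W5) → ¬ (G ≅ complement W5) →
    (c : Fin 5 → Fin (n G)) → InducedCycle G 5 c →
    (u : Fin (n G)) → (∀ i → c i ≢ u) →
    ((countᶠ (λ i → adj G u (c i)) ≡ 2) ×
       (∃ λ m → Edge G u (c m) × Edge G u (c (next5 m))))
    ⊎
    ((countᶠ (λ i → adj G u (c i)) ≡ 3) ×
       ¬ (∃ λ m → Edge G u (c m) × Edge G u (c (next5 m)) × Edge G u (c (next5 (next5 m)))))
lemma6 G simple (no-minor , no-minorᶜ) G≇W5 G≇W5ᶜ c cycle u u∉c =
  [ id , ⊥-elim ∘ [ bad-in-G , bad-in-complement ]′ ]′ (classify (λ i → adj G u (c i)))
  where
  hole : Hole₅ G c
  hole = hole₅ (proj₁ cycle) (inducedCycle-adj {G} cycle)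
  bad-in-G : Bad (λ i → adj G u (c i)) → ⊥
  bad-in-G = [ G≇W5 , no-minor ]′ ∘ bad-pattern⇒W5⊎imperfect simple hole u∉c (λ _ → refl)
  bad-in-complement : Bad (complementPattern (λ i → adj G u (c i))) → ⊥
  bad-in-complement = [ G≇W5ᶜ ∘ complement-≅ simple , no-minorᶜ ]′ ∘
    bad-pattern⇒W5⊎imperfect (complement-simple simple) (Hole₅-complement hole) (u∉c ∘ pentagram)
      (λ i → complement-adj-≢ {G} (u∉c (pentagram i) ∘ sym))
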